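{- There exist a database $D$ and a temporal linear DatalogMTL program $\Pi$ that only uses temporal operators $\boxminus_{\langle t_1,t_2\rangle}$ with $t_2>t_1$ such that there is no time point $T\in\mathbb Q$ with the property that for every $t>T$ and every ground atom $\alpha$: $\alpha@t\in\Pi(D)$ iff $\alpha@T\in\Pi(D)$.
   Context: DatalogMTL over $\mathbb Q$ with continuous semantics. Rules are of the forms $P_1(\boldsymbol\tau_1)\land\dots\land P_n(\boldsymbol\tau_n)\to P_0(\boldsymbol\tau_0)$ and $\boxminus_\varrho P_1(\boldsymbol\tau_1)\to P_0(\boldsymbol\tau_0)$ with non-negative intervals $\varrho$, where $\mathfrak M,t\models\boxminus_\varrho A$ iff $\mathfrak M,s\models A$ for all $s$ with $t-s\in\varrho$. A database is a finite set of facts $A@\varrho$; $\Pi(D)$ is the minimum model of $\Pi$ and $D$, and $\alpha@t\in\Pi(D)$ means $\alpha$ holds at $t$. Dependency graph: vertices are predicates, an edge $(P,Q)$ for each rule with $P$ in body and $Q$ in head, special if the rule has a temporal operator. Two predicates are temporal mutually recursive if they lie on a common cycle containing a special edge. A rule is temporal linear if at most one body predicate is temporal mutually recursive with its head; a program is temporal linear if all its rules are. -}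

module Defs where

open import Data.Nat using (ℕ)
open import Data.Bool using (Bool; true; false)
open import Data.Rational using (ℚ; 0ℚ; _<_; _≤_; _-_)
open import Data.List using (List; []; _∷_)
open import Data.List.Membership.Propositional using (_∈_)
open import Data.List.Relation.Unary.Any using (Any)
open import Data.Fin using (Fin)
open import Data.Product using (Σ; _×_; _,_; ∃)
open import Data.Sum using (_⊎_)
open import Data.Unit using (⊤)
open import Data.Empty using (⊥)
open import Relation.Binary.PropositionalEquality using (_≡_)
open import Level using (Level)

Pred Const Var : Set
Pred  = ℕ
Const = ℕ
Var   = ℕ

data Term : Set where
  var   : Var → Term
  const : Const → Term

record Atom : Set where
  constructor atom
  field
    pred : Pred
    args : List Term
open Atom public

record GAtom : Set where
  constructor gatom
  field
    gpred : Pred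
    gargs : List Const
open GAtom public

data LBound : Set where
  -∞    : LBound
  [_    : ℚ → LBound
  ⟨_    : ℚ → LBound

data UBound : Set where
  +∞    : UBound
  _]    : ℚ → UBound
  _⟩    : ℚ → UBound

record Interval : Set where
  constructor interval
  field
    lo : LBound
    hi : UBound
open Interval public

AboveL : LBound → ℚ → Set
AboveL -∞    t = ⊤
AboveL ([ q) t = q ≤ t
AboveL (⟨ q) t = q < t

BelowU : UBound → ℚ → Set
BelowU +∞    t = ⊤
BelowU (q ]) t = t ≤ q
BelowU (q ⟩) t = t < q

_∈ᵢ_ : ℚ → Interval → Set
t ∈ᵢ ϱ = AboveL (lo ϱ) t × BelowU (hi ϱ) t

NonNeg : Interval → Set
NonNeg (interval -∞    _) = ⊥
NonNeg (interval ([ q) _) = 0ℚ ≤ q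
NonNeg (interval (⟨ q) _) = 0ℚ ≤ q

NonPunctual : Interval → Set
NonPunctual (interval -∞    _)      = ⊤
NonPunctual (interval ([ p) +∞)    = ⊤
NonPunctual (interval ([ p) (q ])) = p < q
NonPunctual (interval ([ p) (q ⟩)) = p < q
NonPunctual (interval (⟨ p) +∞)    = ⊤
NonPunctual (interval (⟨ p) (q ])) = p < q
NonPunctual (interval (⟨ p) (q ⟩)) = p < q

data Rule : Set where
  plain : (body : List Atom) → (head : Atom) → Rule
  boxminus : (ϱ : Interval) → (b : Atom) → (head : Atom) → Rule

Program : Set
Program = List Rule

record Fact : Set where
  constructor _at_
  field
    fatom : GAtom
    fint  : Interval
open Fact public

Database : Set
Database = List Fact

data OccT (x : Var) : Term → Set where
  here : OccT x (var x)

OccA : Var → Atom → Set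
OccA x a = Any (OccT x) (args a)

SafeRule : Rule → Set
SafeRule (plain body h)    = ∀ x → OccA x h → Any (OccA x) body
SafeRule (boxminus ϱ b h)  = ∀ x → OccA x h → OccA x b

WellFormedRule : Rule → Set
WellFormedRule r@(plain _ _)      = SafeRule r
WellFormedRule r@(boxminus ϱ _ _) = SafeRule r × NonNeg ϱ

OnlyNonPunctual : Program → Set
OnlyNonPunctual Π = ∀ {ϱ b h} → boxminus ϱ b h ∈ Π → NonPunctual ϱ

Interpretation : Set₁
Interpretation = GAtom → ℚ → Set

Subst : Set
Subst = Var → Const

groundT : Subst → Term → Const
groundT σ (var x)   = σ x
groundT σ (const c) = c

groundTs : Subst → List Term → List Const
groundTs σ []       = []
groundTs σ (τ ∷ τs) = groundT σ τ ∷ groundTs σ τs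

ground : Subst → Atom → GAtom
ground σ (atom P τs) = gatom P (groundTs σ τs)

BoxMinus : Interpretation → Interval → GAtom → ℚ → Set
BoxMinus M ϱ α t = ∀ s → (t - s) ∈ᵢ ϱ → M α s

SatRule : Interpretation → Rule → Set
SatRule M (plain body h) =
  ∀ (σ : Subst) (t : ℚ) → (∀ {a} → a ∈ body → M (ground σ a) t) → M (ground σ h) t
SatRule M (boxminus ϱ b h) =
  ∀ (σ : Subst) (t : ℚ) → BoxMinus M ϱ (ground σ b) t → M (ground σ h) t

SatFact : Interpretation → Fact → Set
SatFact M (α at ϱ) = ∀ t → t ∈ᵢ ϱ → M α t

IsModel : Program → Database → Interpretation → Set
IsModel Π D M = (∀ {r} → r ∈ Π → SatRule M r) × (∀ {f} → f ∈ D → SatFact M f)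

-- α@t ∈ Π(D): α holds at t in the minimum model of Π and D, i.e. in
-- every model of Π and D (the minimum model is their intersection).
InMin : Program → Database → GAtom → ℚ → Set₁
InMin Π D α t = ∀ (M : Interpretation) → IsModel Π D M → M α t

data Edge (Π : Program) : Pred → Pred → Bool → Set where
  plainE : ∀ {body h a} → plain body h ∈ Π → a ∈ body → Edge Π (pred a) (pred h) false
  boxE   : ∀ {ϱ b h} → boxminus ϱ b h ∈ Π → Edge Π (pred b) (pred h) true

data Walk (Π : Program) : Pred → Pred → Bool → Set where
  one  : ∀ {P Q s} → Edge Π P Q s → Walk Π P Q s
  step : ∀ {P Q R s s'} → Edge Π P Q s → Walk Π Q R s' → Walk Π P R (s Data.Bool.∨ s')

TMR : Program → Pred → Pred → Set
TMR Π P Q = Σ Bool λ s₁ → Σ Bool λ s₂ →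
  Walk Π P Q s₁ × Walk Π Q P s₂ × (s₁ Data.Bool.∨ s₂ ≡ true)

TemporalLinearRule : Program → Rule → Set
TemporalLinearRule Π (plain body h) =
  ∀ (i j : Fin (Data.List.length body)) →
    TMR Π (pred (Data.List.lookup body i)) (pred h) →
    TMR Π (pred (Data.List.lookup body j)) (pred h) → i ≡ j
TemporalLinearRule Π (boxminus _ _ _) = ⊤

TemporalLinear : Program → Set
TemporalLinear Π = ∀ {r} → r ∈ Π → TemporalLinearRule Π r

WellFormedProgram : Program → Set
WellFormedProgram Π = ∀ {r} → r ∈ Π → WellFormedRule r

{-# OPTIONS --safe #-}
-- Take P ← ⊟[3,4] P and P ← ⊟[4,5] P over the database P@[0,2]. Together the two rules
-- carry P on [a, a+2] to P on [a+4, a+6], so every model makes P true on each [4k, 4k+2];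
-- conversely P false exactly on the complement of these intervals gives a model.
-- Hence P holds at 4k but fails at 4k+3 for all k, and since 4k eventually exceeds any
-- T, the minimum model is never constant from some point on.
module Submission where

open import Defs
open import Data.Rational using (ℚ; _<_)
open import Data.Product using (Σ; _×_)
open import Relation.Nullary using (¬_)

open import Agda.Builtin.FromNat using (Number; fromNat)
open import Data.Integer as ℤ using (+_; -[1+_])
import Data.Integer.Properties as ℤ
open import Data.List using ([]; _∷_)
open import Data.List.Membership.Propositional using (_∈_)
open import Data.List.Relation.Unary.Any using (here; there)
open import Data.Nat as ℕ using (ℕ; zero; suc)
import Data.Nat.Literals
import Data.Nat.Properties as ℕ
open import Data.Product using (_,_; proj₁; proj₂; ∃)
open import Data.Rational using (mkℚ; _≤_; _+_; _-_; -_; _≤?_; _<?_; *<*)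
open import Data.Rational.Literals using (number; fromℤ)
open import Data.Rational.Properties
open import Data.Rational.Unnormalised.Base using (*≡*)
import Data.Rational.Unnormalised.Properties as ℚᵘ
open import Data.Unit using (tt)
open import Relation.Binary.PropositionalEquality
open import Relation.Nullary.Decidable using (from-yes; yes; no)
open import Algebra.Properties.Group +-0-group using (//-rightDividesʳ)
open import Algebra.Properties.AbelianGroup +-0-abelianGroup using (⁻¹-anti-homo‿-; xyx⁻¹≈y)

instance
  ℕ-number : Number ℕ
  ℕ-number = Data.Nat.Literals.number

  ℚ-number : Number ℚ
  ℚ-number = number

p+q-q≡p : ∀ p q → p + q - q ≡ p
p+q-q≡p p q = //-rightDividesʳ q p

p-[p-q]≡q : ∀ p q → p - (p - q) ≡ q
p-[p-q]≡q p q = begin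
  p - (p - q)  ≡⟨ cong (_+_ p) (⁻¹-anti-homo‿- p q) ⟩
  p + (q - p)  ≡⟨ +-assoc p q (- p) ⟨
  p + q - p    ≡⟨ xyx⁻¹≈y p q ⟩
  q            ∎
  where open ≡-Reasoning

p≤p+q : ∀ p {q} → 0 ≤ q → p ≤ p + q
p≤p+q p 0≤q = subst (_≤ p + _) (+-identityʳ p) (+-monoʳ-≤ p 0≤q)

p+q≤r⇒p≤r-q : ∀ {p q r} → p + q ≤ r → p ≤ r - q
p+q≤r⇒p≤r-q {p} {q} p+q≤r = subst (_≤ _) (p+q-q≡p p q) (+-monoˡ-≤ (- q) p+q≤r)

r≤p+q⇒r-q≤p : ∀ {p q r} → r ≤ p + q → r - q ≤ p
r≤p+q⇒r-q≤p {p} {q} r≤p+q = subst (_ ≤_) (p+q-q≡p p q) (+-monoˡ-≤ (- q) r≤p+q)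

-‿antimonoʳ-≤ : ∀ r {p q} → p ≤ q → r - q ≤ r - p
-‿antimonoʳ-≤ r p≤q = +-monoʳ-≤ r (neg-antimono-≤ p≤q)

fromℕ : ℕ → ℚ
fromℕ n = fromℤ (+ n)

fromℕ-suc : ∀ n → fromℕ (suc n) ≡ fromℕ n + 1
fromℕ-suc n = toℚᵘ-injective
  (ℚᵘ.≃-trans (*≡* (cong (ℤ._* + 1) numerators)) (ℚᵘ.≃-sym (toℚᵘ-homo-+ (fromℕ n) 1)))
  where
  open ≡-Reasoning
  numerators : + suc n ≡ + n ℤ.* + 1 ℤ.+ + 1
  numerators = begin
    + suc n              ≡⟨ cong +_ (ℕ.+-comm 1 n) ⟩
    + (n ℕ.+ 1)          ≡⟨ ℤ.pos-+ n 1 ⟩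
    + n ℤ.+ + 1          ≡⟨ cong (ℤ._+ + 1) (ℤ.*-identityʳ (+ n)) ⟨
    + n ℤ.* + 1 ℤ.+ + 1  ∎

archimedean : ∀ p → ∃ λ n → p < fromℕ n
archimedean (mkℚ (+ m) d _) = suc m , *<* (subst₂ ℤ._<_ (ℤ.pos-* m 1) (ℤ.pos-* (suc m) (suc d))
  (ℤ.+<+ (subst (ℕ._< suc m ℕ.* suc d) (sym (ℕ.*-identityʳ m)) (ℕ.m≤m*n (suc m) (suc d)))))
archimedean (mkℚ -[1+ m ] d _) = 0 , *<* ℤ.-<+

_×4 : ℕ → ℚ
zero ×4 = 0
suc k ×4 = k ×4 + 4

fromℕ≤×4 : ∀ k → fromℕ k ≤ k ×4
fromℕ≤×4 zero = ≤-refl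
fromℕ≤×4 (suc k) = subst (_≤ suc k ×4) (sym (fromℕ-suc k))
  (+-mono-≤ (fromℕ≤×4 k) (from-yes (1 ≤? 4)))

×4-unbounded : ∀ p → ∃ λ k → p < k ×4
×4-unbounded p with archimedean p
... | k , p<k = k , <-≤-trans p<k (fromℕ≤×4 k)

0≤×4 : ∀ k → 0 ≤ k ×4
0≤×4 zero = ≤-refl
0≤×4 (suc k) = ≤-trans (0≤×4 k) (p≤p+q (k ×4) (from-yes (0 ≤? 4)))

closed : ℚ → ℚ → Interval
closed p q = interval ([ p) (q ])

closed-window : ∀ {p q u s a b} → (u - s) ∈ᵢ closed p q →
  a + q ≤ u → u ≤ b + p → a ≤ s × s ≤ b
closed-window {p} {q} {u} {s} (p≤u-s , u-s≤q) a+q≤u u≤b+p =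
  ≤-trans (p+q≤r⇒p≤r-q a+q≤u) (subst (_ ≤_) (p-[p-q]≡q u s) (-‿antimonoʳ-≤ u u-s≤q)) ,
  ≤-trans (subst (_≤ _) (p-[p-q]≡q u s) (-‿antimonoʳ-≤ u p≤u-s)) (r≤p+q⇒r-q≤p u≤b+p)

P : Atom
P = atom 0 []

Pᵍ : GAtom
Pᵍ = gatom 0 []

program : Program
program = boxminus (closed 3 4) P P ∷ boxminus (closed 4 5) P P ∷ []

database : Database
database = (Pᵍ at closed 0 2) ∷ []

wellFormed : WellFormedProgram program
wellFormed (here refl) = (λ _ ()) , from-yes (0 ≤? 3)
wellFormed (there (here refl)) = (λ _ ()) , from-yes (0 ≤? 4)

temporalLinear : TemporalLinear program
temporalLinear (here refl) = tt
temporalLinear (there (here refl)) = tt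

onlyNonPunctual : OnlyNonPunctual program
onlyNonPunctual (here refl) = from-yes (3 <? 4)
onlyNonPunctual (there (here refl)) = from-yes (4 <? 5)

module _ (M : Interpretation)
         (rule₃₄ : SatRule M (boxminus (closed 3 4) P P))
         (rule₄₅ : SatRule M (boxminus (closed 4 5) P P)) where

  HoldsOn : ℚ → Set
  HoldsOn a = ∀ s → s ∈ᵢ closed a (a + 2) → M Pᵍ s

  -- [a+4, a+5] is reached through ⊟[3,4] and [a+5, a+6] through ⊟[4,5].
  holdsOn-+4 : ∀ a → HoldsOn a → HoldsOn (a + 4)
  holdsOn-+4 a P-on-a u (a+4≤u , u≤a+6) with u ≤? a + 5
  ... | yes u≤a+5 = rule₃₄ (λ _ → 0) u λ s u-s∈[3,4] →
    let a≤s , s≤a+2 = closed-window u-s∈[3,4] a+4≤u (subst (u ≤_) (sym (+-assoc a 2 3)) u≤a+5)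
    in P-on-a s (a≤s , s≤a+2)
  ... | no u≰a+5 = rule₄₅ (λ _ → 0) u λ s u-s∈[4,5] →
    let a≤s , s≤a+2 = closed-window u-s∈[4,5] (<⇒≤ (≰⇒> u≰a+5))
          (subst (u ≤_) (trans (+-assoc a 4 2) (sym (+-assoc a 2 4))) u≤a+6)
    in P-on-a s (a≤s , s≤a+2)

  holdsOn-×4 : HoldsOn 0 → ∀ k → HoldsOn (k ×4)
  holdsOn-×4 P-on-0 zero = P-on-0
  holdsOn-×4 P-on-0 (suc k) = holdsOn-+4 (k ×4) (holdsOn-×4 P-on-0 k)

P-at-×4 : ∀ k → InMin program database Pᵍ (k ×4)
P-at-×4 k M (rules , facts) =
  holdsOn-×4 M (rules (here refl)) (rules (there (here refl))) (facts (here refl)) k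
    (k ×4) (≤-refl , p≤p+q (k ×4) (from-yes (0 ≤? 2)))

-- The complement of ⋃ₖ [4k, 4k+2], so that outsideGap below is the minimum model.
data Gap : ℚ → Set where
  negative : ∀ {s} → s < 0 → Gap s
  shifted  : ∀ {s} → Gap (s - 4) → 2 < s → Gap s

Gap-4 : ∀ {t} → Gap t → Gap (t - 4)
Gap-4 {t} (negative t<0) =
  negative (<-trans (subst (t - 4 <_) (+-identityʳ t) (+-monoʳ-< t (from-yes (- 4 <? 0)))) t<0)
Gap-4 (shifted gap _) = gap

2<×4+3 : ∀ k → 2 < k ×4 + 3
2<×4+3 k = <-≤-trans (from-yes (2 <? 3)) (subst (_≤ k ×4 + 3) (+-identityˡ 3) (+-monoˡ-≤ 3 (0≤×4 k)))

Gap-×4+3 : ∀ k → Gap (k ×4 + 3)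
Gap-×4+3 k = shifted (Gap-×4-1 k) (2<×4+3 k)
  where
  Gap-×4-1 : ∀ j → Gap (j ×4 + 3 - 4)
  Gap-×4-1 zero = negative (from-yes (- 1 <? 0))
  Gap-×4-1 (suc j) = subst Gap (sym (begin
    j ×4 + 4 + 3 - 4  ≡⟨ cong (_- 4) (trans (+-assoc (j ×4) 4 3) (sym (+-assoc (j ×4) 3 4))) ⟩
    j ×4 + 3 + 4 - 4  ≡⟨ p+q-q≡p (j ×4 + 3) 4 ⟩
    j ×4 + 3          ∎)) (Gap-×4+3 j)
    where open ≡-Reasoning

outsideGap : Interpretation
outsideGap _ s = ¬ Gap s

outsideGap-isModel : IsModel program database outsideGap
outsideGap-isModel = rules , facts
  where
  -- Every window of the program contains the point t - 4, where a gap at t recurs.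
  4-back : ∀ {ϱ} t → 4 ∈ᵢ ϱ → (t - (t - 4)) ∈ᵢ ϱ
  4-back {ϱ} t = subst (_∈ᵢ ϱ) (sym (p-[p-q]≡q t 4))

  rules : ∀ {r} → r ∈ program → SatRule outsideGap r
  rules (here refl) _ t ⊟P gap = ⊟P (t - 4) (4-back t (from-yes (3 ≤? 4) , ≤-refl)) (Gap-4 gap)
  rules (there (here refl)) _ t ⊟P gap = ⊟P (t - 4) (4-back t (≤-refl , from-yes (4 ≤? 5))) (Gap-4 gap)
  facts : ∀ {f} → f ∈ database → SatFact outsideGap f
  facts (here refl) t (0≤t , t≤2) (negative t<0) = <-irrefl refl (<-≤-trans t<0 0≤t)
  facts (here refl) t (0≤t , t≤2) (shifted _ 2<t) = <-irrefl refl (<-≤-trans 2<t t≤2)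

¬P-at-×4+3 : ∀ k → ¬ InMin program database Pᵍ (k ×4 + 3)
¬P-at-×4+3 k P-in-min = P-in-min outsideGap outsideGap-isModel (Gap-×4+3 k)

EventuallyConstant : Program → Database → Set₁
EventuallyConstant Π D = Σ ℚ λ T → ∀ (t : ℚ) → T < t → ∀ (α : GAtom) →
  (InMin Π D α t → InMin Π D α T) × (InMin Π D α T → InMin Π D α t)

¬eventuallyConstant : ¬ EventuallyConstant program database
¬eventuallyConstant (T , constant) with ×4-unbounded T
... | k , T<4k = ¬P-at-×4+3 k (proj₂ (constant (k ×4 + 3) T<4k+3 Pᵍ) P-at-T)
  where
  T<4k+3 : T < k ×4 + 3
  T<4k+3 = <-≤-trans T<4k (p≤p+q (k ×4) (from-yes (0 ≤? 3)))
  P-at-T : InMin program database Pᵍ T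
  P-at-T = proj₁ (constant (k ×4) T<4k Pᵍ) (P-at-×4 k)

proposition3 : Σ Database λ D → Σ Program λ Π →
    WellFormedProgram Π × TemporalLinear Π × OnlyNonPunctual Π ×
    ¬ (Σ ℚ λ T → ∀ (t : ℚ) → T < t → ∀ (α : GAtom) →
         (InMin Π D α t → InMin Π D α T) × (InMin Π D α T → InMin Π D α t))
proposition3 = database , program , wellFormed , temporalLinear , onlyNonPunctual , ¬eventuallyConstant
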